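{- Let $G$ be a disconnected graph with exactly one nontrivial connected component $G_1$ and $t > 0$ trivial components, and let $\overline{G}_1$ be the subgraph of $\overline{G}$ induced by the vertices corresponding to $V(G_1)$ (i.e. the complement of $G_1$). If $\mathrm{diam}(\overline{G}_1) \leq 2$, then $h(G\overline{G}) \leq h(\overline{G}_1) + t$.
   Context: All graphs are finite, simple and undirected. For a graph $H$ and $x,y \in V(H)$, the closed interval $I[x,y]$ consists of $x$, $y$ and all vertices lying on some shortest path between $x$ and $y$ in $H$; for $S \subseteq V(H)$, $I[S] = \bigcup_{x,y\in S} I[x,y]$. A set $S$ is (geodetically) convex if $I[S]=S$; the convex hull $H(S)$ is the smallest convex set containing $S$; $S$ is a hull set if $H(S)=V(H)$; the (geodetic) hull number $h(H)$ is the minimum cardinality of a hull set of $H$ (so $h(\overline{G}_1)$ is the hull number of $\overline{G}_1$ as a graph on its own). $\mathrm{diam}$ denotes the diameter. For a graph $G$ with vertex set $\{v_1,\dots,v_n\}$, the complementary prism $G\overline{G}$ has vertex set $\{v_1,\dots,v_n\}\cup\{\overline{v}_1,\dots,\overline{v}_n\}$ and edge set $E(G) \cup \{\overline{v}_i\overline{v}_j : i<j,\ v_iv_j\notin E(G)\} \cup \{v_i\overline{v}_i : 1\le i\le n\}$; $\overline{v}_i$ is the vertex corresponding to $v_i$. A component is trivial if it has exactly one vertex, nontrivial otherwise. -}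

module Defs where

open import Data.Nat using (ℕ; zero; suc; _+_; _≤_)
open import Data.Fin using (Fin; splitAt; _≟_)
open import Data.Fin.Subset using (Subset; _∈_; _⊆_; ∣_∣)
open import Data.Bool using (Bool; true; false; not; _∧_)
open import Data.Sum using (_⊎_; inj₁; inj₂)
open import Data.Product using (Σ; _×_; ∃)
open import Relation.Nullary using (¬_)
open import Relation.Nullary.Decidable using (⌊_⌋)
open import Relation.Binary.PropositionalEquality using (_≡_)

Graph : ℕ → Set
Graph n = Fin n → Fin n → Bool

SimpleGraph : ∀ {n} → Graph n → Set
SimpleGraph {n} G = (∀ x y → G x y ≡ G y x) × (∀ x → G x x ≡ false)

complement : ∀ {n} → Graph n → Graph n
complement G x y = not (G x y) ∧ not ⌊ x ≟ y ⌋

-- complementary prism G Ḡ on Fin (n + n): the first copy is G (vertices v_i),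
-- the second copy is Ḡ (vertices v̄_i), plus the perfect matching v_i v̄_i.
prismAdj : ∀ {n} → Graph n → Fin n ⊎ Fin n → Fin n ⊎ Fin n → Bool
prismAdj G (inj₁ i) (inj₁ j) = G i j
prismAdj G (inj₂ i) (inj₂ j) = complement G i j
prismAdj G (inj₁ i) (inj₂ j) = ⌊ i ≟ j ⌋
prismAdj G (inj₂ i) (inj₁ j) = ⌊ i ≟ j ⌋

prism : ∀ {n} → Graph n → Graph (n + n)
prism {n} G x y = prismAdj G (splitAt n x) (splitAt n y)

-- Everything below is relative to the subgraph H[U] of H induced by U.

data Walk {n} (H : Graph n) (U : Subset n) : Fin n → Fin n → ℕ → Set where
  nil  : ∀ {x} → x ∈ U → Walk H U x x zero
  cons : ∀ {x y z k} → x ∈ U → H x y ≡ true → Walk H U y z k → Walk H U x z (suc k)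

data OnWalk {n} {H : Graph n} {U : Subset n} (z : Fin n) : ∀ {x y k} → Walk H U x y k → Set where
  here-nil  : ∀ {p} → OnWalk z (nil {x = z} p)
  here-cons : ∀ {y w k p e} {r : Walk H U y w k} → OnWalk z (cons {x = z} p e r)
  there     : ∀ {x y w k p e} {r : Walk H U y w k} → OnWalk z r → OnWalk z (cons {x = x} p e r)

Shortest : ∀ {n} (H : Graph n) (U : Subset n) (x y : Fin n) (k : ℕ) → Set
Shortest H U x y k = ∀ m → Walk H U x y m → k ≤ m

InInterval : ∀ {n} (H : Graph n) (U : Subset n) (x y z : Fin n) → Set
InInterval H U x y z =
  z ≡ x ⊎ z ≡ y ⊎
  Σ ℕ (λ k → Σ (Walk H U x y k) (λ w → Shortest H U x y k × OnWalk z w))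

Convex : ∀ {n} (H : Graph n) (U : Subset n) (C : Subset n) → Set
Convex H U C = C ⊆ U × (∀ x y z → x ∈ C → y ∈ C → InInterval H U x y z → z ∈ C)

-- S is a hull set of H[U]: the convex hull H(S) (intersection of all convex
-- supersets of S) is all of U, i.e. every convex superset of S contains U.
HullSet : ∀ {n} (H : Graph n) (U : Subset n) (S : Subset n) → Set
HullSet H U S = S ⊆ U × (∀ C → Convex H U C → S ⊆ C → U ⊆ C)

HullNumber : ∀ {n} (H : Graph n) (U : Subset n) (h : ℕ) → Set
HullNumber H U h =
  Σ (Subset _) (λ S → HullSet H U S × ∣ S ∣ ≡ h) × (∀ S → HullSet H U S → h ≤ ∣ S ∣)

DiamAtMost : ∀ {n} (H : Graph n) (U : Subset n) (d : ℕ) → Set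
DiamAtMost H U d = ∀ x y → x ∈ U → y ∈ U → ∃ (λ k → k ≤ d × Walk H U x y k)

ConnectedOn : ∀ {n} (H : Graph n) (U : Subset n) → Set
ConnectedOn H U = ∀ x y → x ∈ U → y ∈ U → ∃ (λ k → Walk H U x y k)

Isolated : ∀ {n} (H : Graph n) (x : Fin n) → Set
Isolated H x = ∀ y → H x y ≡ false

module Submission where

-- Let V1 = V(G1), let the vertices outside V1 be the isolated
-- vertices t of G, and let S ⊆ V1 be a minimum hull set of Ḡ1.  We show that
--     T = {v_t : t ∉ V1} ∪ {v_s : s ∈ S}   (copies in the G-side of GḠ)
-- is a hull set of GḠ, whence h(GḠ) ≤ |T| ≤ |S| + t.  Fix a convex C ⊇ T.
--   (1) For isolated t and s ≠ t, v_t t̄ s̄ v_s is a geodesic of GḠ (v_t has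
--       t̄ as its only neighbour), so t̄, s̄ ∈ C: every barred copy of S and of
--       the isolated vertices lies in C.
--   (2) Since diam(Ḡ1) ≤ 2, geodesics of Ḡ1 stay geodesics in the barred
--       copy of GḠ, so {v ∈ V1 : v̄ ∈ C} is convex in Ḡ1; it contains the hull
--       set S and hence all of V1.
--   (3) For an edge uw of G, v_u v_w w̄ is a geodesic; since G1 is connected
--       and v_s ∈ C for some s ∈ S, walking along G1 puts every v_w in C.

open import Defs
open import Data.Nat using (suc; _+_; _≤_; _<_; z≤n; s≤s; _≤?_)
open import Data.Nat.Properties using (≤-trans; +-comm; +-identityʳ; module ≤-Reasoning; +-suc; m≤n⇒m≤1+n; ≰⇒>; <⇒≱; ≤-pred)
open import Data.Fin using (Fin; _↑ˡ_; _↑ʳ_; splitAt; _≟_) renaming (zero to fzero; suc to fsuc)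
open import Data.Fin.Properties using (splitAt-↑ˡ; splitAt-↑ʳ; join-splitAt; ↑ˡ-injective; ↑ʳ-injective; all?)
open import Data.Fin.Subset using (Subset; _∈_; _∉_; _⊆_; ∣_∣; ∁; ⊤; Nonempty; _∪_; _∩_; inside; outside) renaming (⊥ to ∅)
open import Data.Fin.Subset.Properties using (_∈?_; nonempty?; ∉⊥; ∈⊤; x∈p∪q⁺; x∈p∩q⁺; x∈p∩q⁻; x∉p⇒x∈∁p; x∈∁p⇒x∉p; ∣⊥∣≡0)
open import Data.Vec using ([]; _∷_; _++_; tabulate; lookup; here; there)
open import Data.Vec.Properties using ([]=⇒lookup; lookup⇒[]=; lookup∘tabulate; lookup-++ˡ)
open import Data.Bool using (true; false)
import Data.Bool as Bool
open import Data.Sum using (inj₁; inj₂)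
open import Data.Product using (_×_; _,_; proj₁; proj₂)
open import Data.Empty using (⊥-elim)
open import Relation.Nullary using (¬_; yes; no)
open import Relation.Nullary.Decidable using (⌊_⌋; dec-true; isYes≗does)
open import Relation.Binary.PropositionalEquality using (_≡_; refl; sym; trans; cong; subst)

∣p∣>0⇒nonempty : ∀ {m} (p : Subset m) → 0 < ∣ p ∣ → Nonempty p
∣p∣>0⇒nonempty (inside ∷ p)  _ = fzero , here
∣p∣>0⇒nonempty (outside ∷ p) h with ∣p∣>0⇒nonempty p h
... | x , x∈p = fsuc x , there x∈p

x∈p⇒x↑ˡ∈p++q : ∀ {m k} (p : Subset m) (q : Subset k) {i} → i ∈ p → (i ↑ˡ k) ∈ (p ++ q)
x∈p⇒x↑ˡ∈p++q p q {i} i∈p = lookup⇒[]= _ (p ++ q) (trans (lookup-++ˡ p q i) ([]=⇒lookup i∈p))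

∣p++q∣≡∣p∣+∣q∣ : ∀ {m k} (p : Subset m) (q : Subset k) → ∣ p ++ q ∣ ≡ ∣ p ∣ + ∣ q ∣
∣p++q∣≡∣p∣+∣q∣ []            q = refl
∣p++q∣≡∣p∣+∣q∣ (inside ∷ p)  q = cong suc (∣p++q∣≡∣p∣+∣q∣ p q)
∣p++q∣≡∣p∣+∣q∣ (outside ∷ p) q = ∣p++q∣≡∣p∣+∣q∣ p q

∣p∪q∣≤∣p∣+∣q∣ : ∀ {m} (p q : Subset m) → ∣ p ∪ q ∣ ≤ ∣ p ∣ + ∣ q ∣
∣p∪q∣≤∣p∣+∣q∣ []            []            = z≤n
∣p∪q∣≤∣p∣+∣q∣ (inside ∷ p)  (inside ∷ q)  =
  s≤s (subst (∣ p ∪ q ∣ ≤_) (sym (+-suc ∣ p ∣ ∣ q ∣)) (m≤n⇒m≤1+n (∣p∪q∣≤∣p∣+∣q∣ p q)))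
∣p∪q∣≤∣p∣+∣q∣ (inside ∷ p)  (outside ∷ q) = s≤s (∣p∪q∣≤∣p∣+∣q∣ p q)
∣p∪q∣≤∣p∣+∣q∣ (outside ∷ p) (inside ∷ q)  =
  subst (suc ∣ p ∪ q ∣ ≤_) (sym (+-suc ∣ p ∣ ∣ q ∣)) (s≤s (∣p∪q∣≤∣p∣+∣q∣ p q))
∣p∪q∣≤∣p∣+∣q∣ (outside ∷ p) (outside ∷ q) = ∣p∪q∣≤∣p∣+∣q∣ p q

outside≢inside : ∀ {m} {p : Subset m} {t s} → t ∉ p → s ∈ p → ¬ t ≡ s
outside≢inside t∉p s∈p refl = t∉p s∈p

≟-refl : ∀ {m} (i : Fin m) → ⌊ i ≟ i ⌋ ≡ true
≟-refl i = trans (isYes≗does (i ≟ i)) (dec-true (i ≟ i) refl)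

≟-sound : ∀ {m} {i j : Fin m} → ⌊ i ≟ j ⌋ ≡ true → i ≡ j
≟-sound {i = i} {j} e with i ≟ j
... | yes i≡j = i≡j
≟-sound () | no _

module _ {n} {H : Graph n} {U : Subset n} where

  onWalk⇒∈ : ∀ {z x y k} {w : Walk H U x y k} → OnWalk z w → z ∈ U
  onWalk⇒∈ (here-nil {p = z∈U})  = z∈U
  onWalk⇒∈ (here-cons {p = z∈U}) = z∈U
  onWalk⇒∈ (there z∈w)           = onWalk⇒∈ z∈w

  start∈ : ∀ {x y k} → Walk H U x y k → x ∈ U
  start∈ (nil x∈U)      = x∈U
  start∈ (cons x∈U _ _) = x∈U

  convex-geodesic : ∀ {C x y z k} → Convex H U C → x ∈ C → y ∈ C →
                    (w : Walk H U x y k) → Shortest H U x y k → OnWalk z w → z ∈ C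
  convex-geodesic {x = x} {y} {z} {k} (_ , closed) x∈C y∈C w shortest z∈w =
    closed x y z x∈C y∈C (inj₂ (inj₂ (k , w , shortest , z∈w)))

  -- The empty set is convex, so a hull set of a nonempty graph is nonempty.
  hullSet-nonempty : ∀ {S} → HullSet H U S → Nonempty U → Nonempty S
  hullSet-nonempty {S} (_ , hull) (u , u∈U) with nonempty? S
  ... | yes S≠∅ = S≠∅
  ... | no  S=∅ = ⊥-elim (∉⊥ (hull ∅ ∅-convex (λ {x} x∈S → ⊥-elim (S=∅ (x , x∈S))) u∈U))
    where
      ∅-convex : Convex H U ∅
      ∅-convex = (λ x∈∅ → ⊥-elim (∉⊥ x∈∅)) , (λ _ _ _ x∈∅ _ _ → ⊥-elim (∉⊥ x∈∅))

-- A vertex that is not non-isolated is isolated (isolation is decidable).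
isolated-stable : ∀ {n} (G : Graph n) x → ¬ ¬ Isolated G x → Isolated G x
isolated-stable G x ¬¬iso with all? (λ y → G x y Bool.≟ false)
... | yes iso = iso
... | no ¬iso = ⊥-elim (¬¬iso ¬iso)

module Prism {n} (G : Graph n) (irreflexive : ∀ x → G x x ≡ false) where

  P : Graph (n + n)
  P = prism G

  orig bar : Fin n → Fin (n + n)
  orig i = i ↑ˡ n
  bar  i = n ↑ʳ i

  adj-orig-orig : ∀ i j → P (orig i) (orig j) ≡ G i j
  adj-orig-orig i j rewrite splitAt-↑ˡ n i n | splitAt-↑ˡ n j n = refl

  adj-bar-bar : ∀ i j → P (bar i) (bar j) ≡ complement G i j
  adj-bar-bar i j rewrite splitAt-↑ʳ n n i | splitAt-↑ʳ n n j = refl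

  adj-orig-bar : ∀ i j → P (orig i) (bar j) ≡ ⌊ i ≟ j ⌋
  adj-orig-bar i j rewrite splitAt-↑ˡ n i n | splitAt-↑ʳ n n j = refl

  adj-bar-orig : ∀ i j → P (bar i) (orig j) ≡ ⌊ i ≟ j ⌋
  adj-bar-orig i j rewrite splitAt-↑ʳ n n i | splitAt-↑ˡ n j n = refl

  matching : ∀ i → P (orig i) (bar i) ≡ true
  matching i = trans (adj-orig-bar i i) (≟-refl i)

  matching′ : ∀ i → P (bar i) (orig i) ≡ true
  matching′ i = trans (adj-bar-orig i i) (≟-refl i)

  orig≢bar : ∀ i j → ¬ orig i ≡ bar j
  orig≢bar i j e with trans (sym (splitAt-↑ˡ n i n)) (trans (cong (splitAt n) e) (splitAt-↑ʳ n n j))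
  ... | ()

  data PrismVertex (x : Fin (n + n)) : Set where
    is-orig : ∀ i → x ≡ orig i → PrismVertex x
    is-bar  : ∀ i → x ≡ bar i  → PrismVertex x

  prismVertex : ∀ x → PrismVertex x
  prismVertex x with splitAt n x | join-splitAt n n x
  ... | inj₁ i | e = is-orig i (sym e)
  ... | inj₂ i | e = is-bar  i (sym e)

  -- (1) For isolated t and s ≠ t, the path v_t t̄ s̄ v_s has length 3 ...
  isolated-path : ∀ t s → Isolated G t → ¬ t ≡ s → Walk P ⊤ (orig t) (orig s) 3
  isolated-path t s iso t≢s =
    cons ∈⊤ (matching t) (cons ∈⊤ (trans (adj-bar-bar t s) t̄s̄) (cons ∈⊤ (matching′ s) (nil ∈⊤)))
    where
      t̄s̄ : complement G t s ≡ true
      t̄s̄ rewrite iso s with t ≟ s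
      ... | yes t≡s = ⊥-elim (t≢s t≡s)
      ... | no  _   = refl

  -- ... and is a geodesic: v_t's only neighbour is t̄, which is not adjacent to v_s.
  -- (Endpoints are given by equations so that short walks can be pattern matched.)
  isolated-distance : ∀ t s → Isolated G t → ¬ t ≡ s →
                      ∀ {x y m} → Walk P ⊤ x y m → x ≡ orig t → y ≡ orig s → 3 ≤ m
  isolated-distance t s iso t≢s (nil _) refl e = ⊥-elim (t≢s (↑ˡ-injective n t s e))
  isolated-distance t s iso t≢s (cons _ e (nil _)) refl refl
    with trans (sym (trans (sym (adj-orig-orig t s)) e)) (iso s)
  ... | ()
  isolated-distance t s iso t≢s (cons {y = x} _ e (cons _ e′ (nil _))) refl refl
    with prismVertex x
  ... | is-orig j refl with trans (sym (trans (sym (adj-orig-orig t j)) e)) (iso j)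
  ... | ()
  isolated-distance t s iso t≢s (cons {y = x} _ e (cons _ e′ (nil _))) refl refl
      | is-bar j refl =
    ⊥-elim (t≢s (trans (≟-sound (trans (sym (adj-orig-bar t j)) e)) (≟-sound (trans (sym (adj-bar-orig j s)) e′))))
  isolated-distance t s iso t≢s (cons _ _ (cons _ _ (cons _ _ _))) _ _ = s≤s (s≤s (s≤s z≤n))

  isolated-bars : ∀ {C t s} → Convex P ⊤ C → Isolated G t → ¬ t ≡ s →
                  orig t ∈ C → orig s ∈ C → bar t ∈ C × bar s ∈ C
  isolated-bars {C} {t} {s} convC iso t≢s t∈C s∈C =
    on-geodesic (there here-cons) , on-geodesic (there (there here-cons))
    where
      on-geodesic : ∀ {z} → OnWalk z (isolated-path t s iso t≢s) → z ∈ C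
      on-geodesic = convex-geodesic convC t∈C s∈C (isolated-path t s iso t≢s)
                      (λ m w → isolated-distance t s iso t≢s w refl refl)

  -- (3) For an edge uw of G, the path v_u v_w w̄ is a geodesic (v_u ≁ w̄ as u ≠ w).
  edge-path : ∀ u w → G u w ≡ true → Walk P ⊤ (orig u) (bar w) 2
  edge-path u w uw = cons ∈⊤ (trans (adj-orig-orig u w) uw) (cons ∈⊤ (matching w) (nil ∈⊤))

  edge-distance : ∀ u w → G u w ≡ true → ∀ {x y m} → Walk P ⊤ x y m → x ≡ orig u → y ≡ bar w → 2 ≤ m
  edge-distance u w uw (nil _) refl e = ⊥-elim (orig≢bar u w e)
  edge-distance u w uw (cons _ e (nil _)) refl refl with ≟-sound (trans (sym (adj-orig-bar u w)) e)
  ... | refl with trans (sym uw) (irreflexive u)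
  ... | ()
  edge-distance u w uw (cons _ _ (cons _ _ _)) _ _ = s≤s (s≤s z≤n)

  module _ (V1 : Subset n) where

    lift-walk : ∀ {a c k} → Walk (complement G) V1 a c k → Walk P ⊤ (bar a) (bar c) k
    lift-walk (nil _)                        = nil ∈⊤
    lift-walk (cons {x = x} {y = y} _ e rest) = cons ∈⊤ (trans (adj-bar-bar x y) e) (lift-walk rest)

    lift-onWalk : ∀ {z a c k} {w : Walk (complement G) V1 a c k} → OnWalk z w → OnWalk (bar z) (lift-walk w)
    lift-onWalk here-nil    = here-nil
    lift-onWalk here-cons   = here-cons
    lift-onWalk (there z∈w) = there (lift-onWalk z∈w)

    short-walk-descends : ∀ a c {x y m} → Walk P ⊤ x y m → x ≡ bar a → y ≡ bar c → m ≤ 1 →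
                          a ∈ V1 → c ∈ V1 → Walk (complement G) V1 a c m
    short-walk-descends a c (nil _) refl e _ a∈V1 _ =
      subst (λ c′ → Walk (complement G) V1 a c′ 0) (↑ʳ-injective n a c e) (nil a∈V1)
    short-walk-descends a c (cons _ e (nil _)) refl refl _ a∈V1 c∈V1 =
      cons a∈V1 (trans (sym (adj-bar-bar a c)) e) (nil c∈V1)
    short-walk-descends a c (cons _ _ (cons _ _ _)) _ _ (s≤s ()) _ _

    lift-shortest : ∀ {a c k} → k ≤ 2 → a ∈ V1 → c ∈ V1 →
                    Shortest (complement G) V1 a c k → Shortest P ⊤ (bar a) (bar c) k
    lift-shortest {a} {c} {k} k≤2 a∈V1 c∈V1 shortest m w with k ≤? m
    ... | yes k≤m = k≤m
    ... | no  k≰m = ⊥-elim (<⇒≱ m<k (shortest m (short-walk-descends a c w refl refl m≤1 a∈V1 c∈V1)))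
      where
        m<k = ≰⇒> k≰m
        m≤1 : m ≤ 1
        m≤1 = ≤-pred (≤-trans m<k k≤2)

    barTrace : Subset (n + n) → Subset n
    barTrace C = V1 ∩ tabulate (λ v → lookup C (bar v))

    barTrace⁺ : ∀ C {v} → v ∈ V1 → bar v ∈ C → v ∈ barTrace C
    barTrace⁺ C {v} v∈V1 v̄∈C =
      x∈p∩q⁺ (v∈V1 , lookup⇒[]= v _ (trans (lookup∘tabulate _ v) ([]=⇒lookup v̄∈C)))

    barTrace⁻ : ∀ C {v} → v ∈ barTrace C → v ∈ V1 × bar v ∈ C
    barTrace⁻ C {v} v∈T with x∈p∩q⁻ V1 _ v∈T
    ... | v∈V1 , v∈tab =
      v∈V1 , lookup⇒[]= (bar v) C
               (trans (sym (lookup∘tabulate (λ u → lookup C (bar u)) v)) ([]=⇒lookup v∈tab))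

    barTrace-convex : DiamAtMost (complement G) V1 2 → ∀ {C} → Convex P ⊤ C →
                      Convex (complement G) V1 (barTrace C)
    barTrace-convex diam {C} convC = (λ v∈T → proj₁ (barTrace⁻ C v∈T)) , closed
      where
        closed : ∀ x y z → x ∈ barTrace C → y ∈ barTrace C →
                 InInterval (complement G) V1 x y z → z ∈ barTrace C
        closed x y z x∈T y∈T (inj₁ refl)        = x∈T
        closed x y z x∈T y∈T (inj₂ (inj₁ refl)) = y∈T
        closed x y z x∈T y∈T (inj₂ (inj₂ (k , w , shortest , z∈w)))
          with barTrace⁻ C x∈T | barTrace⁻ C y∈T | diam x y (proj₁ (barTrace⁻ C x∈T)) (proj₁ (barTrace⁻ C y∈T))
        ... | x∈V1 , x̄∈C | y∈V1 , ȳ∈C | k′ , k′≤2 , w′ =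
          barTrace⁺ C (onWalk⇒∈ z∈w)
            (convex-geodesic convC x̄∈C ȳ∈C (lift-walk w)
              (lift-shortest (≤-trans (shortest k′ w′) k′≤2) x∈V1 y∈V1 shortest)
              (lift-onWalk z∈w))

    spread-along-G : ∀ {C} → Convex P ⊤ C → (∀ v → v ∈ V1 → bar v ∈ C) →
                     ∀ {x y k} → Walk G V1 x y k → orig x ∈ C → orig y ∈ C
    spread-along-G convC bars (nil _) x∈C = x∈C
    spread-along-G convC bars (cons {x = x} {y = y} _ xy rest) x∈C =
      spread-along-G convC bars rest
        (convex-geodesic convC x∈C (bars y (start∈ rest)) (edge-path x y xy)
          (λ m p → edge-distance x y xy p refl refl) (there here-cons))

  prism-hullSet : (V1 : Subset n) → (∀ t → t ∉ V1 → Isolated G t) → ConnectedOn G V1 →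
                  DiamAtMost (complement G) V1 2 → Nonempty (∁ V1) →
                  ∀ S → HullSet (complement G) V1 S → Nonempty S →
                  HullSet P ⊤ ((∁ V1 ∪ S) ++ ∅)
  prism-hullSet V1 isolated conn diam (t₀ , t₀∈∁V1) S (S⊆V1 , S-hull) (s₀ , s₀∈S) =
    (λ _ → ∈⊤) , λ C convC T⊆C {x} _ → covers C convC T⊆C (prismVertex x)
    where
      covers : ∀ C → Convex P ⊤ C → (∁ V1 ∪ S) ++ ∅ ⊆ C → ∀ {x} → PrismVertex x → x ∈ C
      covers C convC T⊆C = final
        where
          origIso : ∀ t → t ∉ V1 → orig t ∈ C
          origIso t t∉V1 = T⊆C (x∈p⇒x↑ˡ∈p++q _ ∅ (x∈p∪q⁺ (inj₁ (x∉p⇒x∈∁p t∉V1))))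

          origS : ∀ s → s ∈ S → orig s ∈ C
          origS s s∈S = T⊆C (x∈p⇒x↑ˡ∈p++q _ ∅ (x∈p∪q⁺ (inj₂ s∈S)))

          t₀∉V1 : t₀ ∉ V1
          t₀∉V1 = x∈∁p⇒x∉p t₀∈∁V1

          -- Step (1): geodesics from an isolated vertex to S pass through both bars.
          barIso : ∀ t → t ∉ V1 → bar t ∈ C
          barIso t t∉V1 = proj₁ (isolated-bars convC (isolated t t∉V1) (outside≢inside t∉V1 (S⊆V1 s₀∈S))
                                  (origIso t t∉V1) (origS s₀ s₀∈S))

          barS : ∀ s → s ∈ S → bar s ∈ C
          barS s s∈S = proj₂ (isolated-bars convC (isolated t₀ t₀∉V1) (outside≢inside t₀∉V1 (S⊆V1 s∈S))
                                (origIso t₀ t₀∉V1) (origS s s∈S))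

          -- S lies in the convex bar-trace of C, so that trace is all of V1.
          barV1 : ∀ v → v ∈ V1 → bar v ∈ C
          barV1 v v∈V1 = proj₂ (barTrace⁻ V1 C (S-hull (barTrace V1 C) (barTrace-convex V1 diam convC)
                                  (λ {s} s∈S → barTrace⁺ V1 C (S⊆V1 s∈S) (barS s s∈S)) v∈V1))

          -- Step (3): spread from v_{s₀} along G1, which is connected.
          origV1 : ∀ v → v ∈ V1 → orig v ∈ C
          origV1 v v∈V1 = spread-along-G V1 convC barV1 (proj₂ (conn s₀ v (S⊆V1 s₀∈S) v∈V1)) (origS s₀ s₀∈S)

          final : ∀ {x} → PrismVertex x → x ∈ C
          final (is-orig i refl) with i ∈? V1
          ... | yes i∈V1 = origV1 i i∈V1
          ... | no  i∉V1 = origIso i i∉V1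
          final (is-bar i refl) with i ∈? V1
          ... | yes i∈V1 = barV1 i i∈V1
          ... | no  i∉V1 = barIso i i∉V1

theorem6 : ∀ {n} (G : Graph n) → SimpleGraph G →
    (V1 : Subset n) →
    (∀ x → x ∈ V1 → ¬ Isolated G x) →
    (∀ x → ¬ Isolated G x → x ∈ V1) →
    Nonempty V1 →
    ConnectedOn G V1 →
    0 < ∣ ∁ V1 ∣ →
    DiamAtMost (complement G) V1 2 →
    ∀ a b → HullNumber (prism G) ⊤ a → HullNumber (complement G) V1 b →
    a ≤ b + ∣ ∁ V1 ∣
theorem6 {n} G (_ , irreflexive) V1 _ nonIsolated⇒∈V1 V1≠∅ conn t>0 diam a b
  (_ , a-minimal) ((S , S-hull , ∣S∣≡b) , _) =
  ≤-trans (a-minimal T T-hull) ∣T∣≤b+t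
  where
    open Prism G irreflexive
    T : Subset (n + n)
    T = (∁ V1 ∪ S) ++ ∅

    isolated : ∀ t → t ∉ V1 → Isolated G t
    isolated t t∉V1 = isolated-stable G t (λ ¬iso → t∉V1 (nonIsolated⇒∈V1 t ¬iso))

    T-hull : HullSet P ⊤ T
    T-hull = prism-hullSet V1 isolated conn diam (∣p∣>0⇒nonempty (∁ V1) t>0)
               S S-hull (hullSet-nonempty S-hull V1≠∅)

    ∣T∣≤b+t : ∣ T ∣ ≤ b + ∣ ∁ V1 ∣
    ∣T∣≤b+t = begin
      ∣ T ∣                  ≡⟨ ∣p++q∣≡∣p∣+∣q∣ (∁ V1 ∪ S) ∅ ⟩
      ∣ ∁ V1 ∪ S ∣ + ∣ ∅ {n} ∣ ≡⟨ cong (∣ ∁ V1 ∪ S ∣ +_) (∣⊥∣≡0 n) ⟩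
      ∣ ∁ V1 ∪ S ∣ + 0        ≡⟨ +-identityʳ _ ⟩
      ∣ ∁ V1 ∪ S ∣            ≤⟨ ∣p∪q∣≤∣p∣+∣q∣ (∁ V1) S ⟩
      ∣ ∁ V1 ∣ + ∣ S ∣        ≡⟨ cong (∣ ∁ V1 ∣ +_) ∣S∣≡b ⟩
      ∣ ∁ V1 ∣ + b            ≡⟨ +-comm ∣ ∁ V1 ∣ b ⟩
      b + ∣ ∁ V1 ∣            ∎
      where open ≤-Reasoning
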